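{- Let $\mathrm{H}$ be a finite group and $\sigma\in\mathrm{Aut}(\mathrm{H})$ with $\sigma^2=\mathrm{Id}$. If $\mathcal{G}_{\mathrm{TF}}(\mathrm{H},\sigma)=|\mathrm{H}|$, then there exists $k\in\mathbb{Z}_{\ge0}$ such that $\mathrm{H}\cong\mathbb{Z}_2^k$ and $\sigma=\mathrm{Id}$.
   Context: $\mathbb{Z}_2=\{e,x\}$, $\mathrm{H}\rtimes_\theta\mathbb{Z}_2$ is the semidirect product with $\theta(x)=\sigma$ (so $xhx=\sigma(h)$), $\mathrm{H}$ is identified with $\mathrm{H}\times\{e\}$; $S(\mathrm{H},\sigma)$ is the set of $g\in\mathrm{H}\rtimes_\theta\mathbb{Z}_2$ with $g\notin\mathrm{H}$ and $g^2=e$; $\mathcal{G}_{\mathrm{TF}}(\mathrm{H},\sigma)$ is the number of conjugacy classes of $\mathrm{H}\rtimes_\theta\mathbb{Z}_2$ contained in $S(\mathrm{H},\sigma)$. -}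

module Defs where

open import Data.Nat using (ℕ)
open import Data.Fin using (Fin)
open import Data.Bool using (Bool; true; false; _xor_)
open import Data.Vec using (Vec; zipWith)
open import Data.Product using (_×_; _,_; Σ; ∃; proj₁; proj₂)
open import Relation.Binary.PropositionalEquality using (_≡_)
open import Relation.Nullary using (¬_)
open import Algebra.Structures using (IsGroup)

-- A finite group of order n, presented (up to isomorphism) on the carrier Fin n
-- with propositional equality.
record FinGroup (n : ℕ) : Set where
  field
    _∙_     : Fin n → Fin n → Fin n
    ε       : Fin n
    _⁻¹     : Fin n → Fin n
    isGroup : IsGroup _≡_ _∙_ ε _⁻¹

record IsAutomorphism {n : ℕ} (H : FinGroup n) (σ : Fin n → Fin n) : Set where
  open FinGroup H
  field
    hom     : ∀ a b → σ (a ∙ b) ≡ σ a ∙ σ b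
    inverse : Σ (Fin n → Fin n) λ τ → (∀ a → τ (σ a) ≡ a) × (∀ a → σ (τ a) ≡ a)

module SemiDirect {n : ℕ} (H : FinGroup n) (σ : Fin n → Fin n) where
  open FinGroup H

  -- Elements of H ⋊_θ ℤ₂ : pairs (h , b), b = false ↔ e, b = true ↔ x
  G : Set
  G = Fin n × Bool

  θ : Bool → Fin n → Fin n
  θ false h = h
  θ true  h = σ h

  _·_ : G → G → G
  (h₁ , b₁) · (h₂ , b₂) = (h₁ ∙ θ b₁ h₂ , b₁ xor b₂)

  1G : G
  1G = (ε , false)

  InS : G → Set
  InS g = (proj₂ g ≡ true) × (g · g ≡ 1G)

  -- g and g' are conjugate in H ⋊ ℤ₂ : ∃ k, k g k⁻¹ = g'  (equivalently k g = g' k)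
  Conj : G → G → Set
  Conj g g' = ∃ λ k → k · g ≡ g' · k

  -- 𝒢_TF(H,σ) = m : there is a complete, irredundant system of m representatives
  -- of the conjugacy classes of H ⋊ ℤ₂ contained in S(H,σ).
  -- (S is closed under conjugation, so these are exactly the classes meeting S.)
  record TFClassCount (m : ℕ) : Set where
    field
      rep       : Fin m → G
      rep-in-S  : ∀ i → InS (rep i)
      distinct  : ∀ i j → Conj (rep i) (rep j) → i ≡ j
      complete  : ∀ g → InS g → ∃ λ i → Conj g (rep i)

record IsoToZ2Pow {n : ℕ} (H : FinGroup n) (k : ℕ) : Set where
  open FinGroup H
  field
    f     : Fin n → Vec Bool k
    g     : Vec Bool k → Fin n
    gf    : ∀ a → g (f a) ≡ a
    fg    : ∀ v → f (g v) ≡ v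
    f-hom : ∀ a b → f (a ∙ b) ≡ zipWith _xor_ (f a) (f b)

-- S(H,σ) lies in the coset {(h , x)} of size |H|, so |H| classes inside S
-- force every (h , x) to be an involution forming a class on its own. Conjugating (h , x) by (k , e) gives (k h σ(k)⁻¹ , x),
-- so k h = h σ(k) for all h, k: taking h = e gives σ = id, and then H is
-- abelian. An involution (h , x) has square (h σ(h) , e) = (h² , e), so H is
-- an elementary abelian 2-group, i.e. a finite ℤ₂-vector space, and a basis
-- is found by adjoining elements outside the current span until it is all of H.
module Submission where

open import Defs
open import Level using (0ℓ)
open import Algebra.Bundles using (AbelianGroup)
import Algebra.Properties.AbelianGroup as AbelianGroupProperties
import Algebra.Properties.CommutativeSemigroup as CommutativeSemigroupProperties
open import Data.Nat using (ℕ; zero; suc; _+_; _≤_)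
open import Data.Nat.Properties using (+-suc; +-identityʳ; 1+n≰n)
open import Data.Fin using (Fin; punchOut; _≟_)
open import Data.Fin.Properties using (any?; all?; ¬∀⟶∃¬; injective⇒≤; punchOut-injective)
open import Data.Fin.Subset using (⁅_⁆; _∈_)
open import Data.Fin.Subset.Properties using (anySubset?; x∈⁅x⁆; x∈⁅y⁆⇒x≡y)
open import Data.Bool using (Bool; true; false; _xor_)
open import Data.Vec using (Vec; []; _∷_; zipWith)
open import Data.Product using (_×_; ∃; _,_; proj₁; proj₂)
open import Data.Empty using (⊥-elim)
open import Algebra.Structures using (IsGroup)
open import Function.Definitions using (Injective)
open import Relation.Nullary using (Dec; yes; no; ¬_; contradiction)
open import Relation.Binary.PropositionalEquality

injective⇒surjective : ∀ {n} {f : Fin n → Fin n} → Injective _≡_ _≡_ f →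
                       ∀ y → ∃ λ x → f x ≡ y
injective⇒surjective {f = f} f-inj y with any? (λ x → f x ≟ y)
... | yes hit = hit
injective⇒surjective {suc m} {f} f-inj y | no miss =
  contradiction (injective⇒≤ {f = λ x → punchOut (avoids x)} punchOut∘f-injective) 1+n≰n
  where
  avoids : ∀ x → y ≢ f x
  avoids x e = miss (x , sym e)

  punchOut∘f-injective : ∀ {x x′} → punchOut (avoids x) ≡ punchOut (avoids x′) → x ≡ x′
  punchOut∘f-injective e = f-inj (punchOut-injective (avoids _) (avoids _) e)

⁅⁆-injective : ∀ {k} → Injective _≡_ _≡_ (⁅_⁆ {k})
⁅⁆-injective {x = i} {j} e = x∈⁅y⁆⇒x≡y j (subst (i ∈_) e (x∈⁅x⁆ i))

module ElementaryAbelian {n : ℕ} (H : FinGroup n)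
  (comm : ∀ x y → FinGroup._∙_ H x y ≡ FinGroup._∙_ H y x)
  (square : ∀ x → FinGroup._∙_ H x x ≡ FinGroup.ε H) where

  open FinGroup H

  abelianGroup : AbelianGroup 0ℓ 0ℓ
  abelianGroup = record { isAbelianGroup = record { isGroup = isGroup ; comm = comm } }

  open AbelianGroup abelianGroup using (assoc; identityˡ; identityʳ; commutativeSemigroup)
  open AbelianGroupProperties abelianGroup using (∙-cancelˡ)
  open CommutativeSemigroupProperties commutativeSemigroup using (interchange)

  x∙y≡z⇒x≡z∙y : ∀ x y z → x ∙ y ≡ z → x ≡ z ∙ y
  x∙y≡z⇒x≡z∙y x y z e = begin
    x             ≡⟨ identityʳ x ⟨
    x ∙ ε         ≡⟨ cong (x ∙_) (square y) ⟨
    x ∙ (y ∙ y)   ≡⟨ assoc x y y ⟨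
    (x ∙ y) ∙ y   ≡⟨ cong (_∙ y) e ⟩
    z ∙ y         ∎
    where open ≡-Reasoning

  infix 25 _^_
  _^_ : Fin n → Bool → Fin n
  a ^ true  = a
  a ^ false = ε

  ^-xor : ∀ a b c → a ^ (b xor c) ≡ a ^ b ∙ a ^ c
  ^-xor a false false = sym (identityˡ ε)
  ^-xor a false true  = sym (identityˡ a)
  ^-xor a true  false = sym (identityʳ a)
  ^-xor a true  true  = sym (square a)

  record Z₂^Embedding (k : ℕ) : Set where
    field
      embed     : Vec Bool k → Fin n
      hom       : ∀ v w → embed (zipWith _xor_ v w) ≡ embed v ∙ embed w
      injective : Injective _≡_ _≡_ embed

    Spanned : Fin n → Set
    Spanned a = ∃ λ v → embed v ≡ a

    spanned? : ∀ a → Dec (Spanned a)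
    spanned? a = anySubset? (λ v → embed v ≟ a)

    dimension≤order : k ≤ n
    dimension≤order = injective⇒≤ (λ e → ⁅⁆-injective (injective e))

  open Z₂^Embedding

  embedding₀ : Z₂^Embedding 0
  embedding₀ = record
    { embed     = λ _ → ε
    ; hom       = λ _ _ → sym (identityˡ ε)
    ; injective = λ { {[]} {[]} _ → refl }
    }

  extend : ∀ {k} (E : Z₂^Embedding k) (a : Fin n) → ¬ Spanned E a → Z₂^Embedding (suc k)
  extend {k} E a a∉E = record { embed = embed′ ; hom = hom′ ; injective = injective′ }
    where
    embed′ : Vec Bool (suc k) → Fin n
    embed′ (b ∷ v) = a ^ b ∙ embed E v

    hom′ : ∀ v w → embed′ (zipWith _xor_ v w) ≡ embed′ v ∙ embed′ w
    hom′ (b ∷ v) (c ∷ w) =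
      trans (cong₂ _∙_ (^-xor a b c) (hom E v w)) (interchange (a ^ b) (a ^ c) (embed E v) (embed E w))

    a∙v≢w : ∀ v w → a ∙ embed E v ≢ ε ∙ embed E w
    a∙v≢w v w e =
      a∉E (zipWith _xor_ w v , trans (hom E w v)
             (sym (x∙y≡z⇒x≡z∙y a (embed E v) (embed E w) (trans e (identityˡ (embed E w))))))

    injective′ : Injective _≡_ _≡_ embed′
    injective′ {true  ∷ v} {true  ∷ w} e = cong (true ∷_) (injective E (∙-cancelˡ a _ _ e))
    injective′ {false ∷ v} {false ∷ w} e = cong (false ∷_) (injective E (∙-cancelˡ ε _ _ e))
    injective′ {true  ∷ v} {false ∷ w} e = ⊥-elim (a∙v≢w v w e)
    injective′ {false ∷ v} {true  ∷ w} e = ⊥-elim (a∙v≢w w v (sym e))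

  spanning⇒iso : ∀ {k} (E : Z₂^Embedding k) → (∀ a → Spanned E a) → IsoToZ2Pow H k
  spanning⇒iso E spans = record
    { f     = coords
    ; g     = embed E
    ; gf    = λ a → proj₂ (spans a)
    ; fg    = λ v → injective E (proj₂ (spans (embed E v)))
    ; f-hom = λ a b → injective E (trans (proj₂ (spans (a ∙ b)))
                (sym (trans (hom E (coords a) (coords b))
                            (cong₂ _∙_ (proj₂ (spans a)) (proj₂ (spans b))))))
    }
    where
    coords : Fin n → Vec Bool _
    coords a = proj₁ (spans a)

  -- The slack bounds the number of extensions still possible, as k ≤ n.
  completeBasis : ∀ slack {k} → slack + k ≡ suc n → Z₂^Embedding k → ∃ λ k → IsoToZ2Pow H k
  completeBasis zero        refl E = contradiction (dimension≤order E) 1+n≰n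
  completeBasis (suc slack) eq   E with all? (spanned? E)
  ... | yes spans = _ , spanning⇒iso E spans
  ... | no ¬spans with ¬∀⟶∃¬ n _ (spanned? E) ¬spans
  ...   | a , a∉E = completeBasis slack (trans (+-suc slack _) eq) (extend E a a∉E)

  iso-Z₂^ : ∃ λ k → IsoToZ2Pow H k
  iso-Z₂^ = completeBasis (suc n) (cong suc (+-identityʳ n)) embedding₀

module OuterCoset {n : ℕ} (H : FinGroup n) (σ : Fin n → Fin n) where

  open FinGroup H
  open IsGroup isGroup using (assoc; identityˡ; identityʳ; inverseˡ)
  open SemiDirect H σ

  conj-by-H : ∀ k h h′ → h′ ∙ σ k ≡ k ∙ h → Conj (h , true) (h′ , true)
  conj-by-H k h h′ e = (k , false) , cong (_, true) (sym e)

  module SingletonClasses (singleton : ∀ h h′ → Conj (h , true) (h′ , true) → h ≡ h′) where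

    twisted-comm : ∀ h k → h ∙ σ k ≡ k ∙ h
    twisted-comm h k = trans (cong (_∙ σ k) h≡h′) h′∙σk≡k∙h
      where
      h′ : Fin n
      h′ = (k ∙ h) ∙ (σ k ⁻¹)

      h′∙σk≡k∙h : h′ ∙ σ k ≡ k ∙ h
      h′∙σk≡k∙h = begin
        ((k ∙ h) ∙ (σ k ⁻¹)) ∙ σ k ≡⟨ assoc (k ∙ h) (σ k ⁻¹) (σ k) ⟩
        (k ∙ h) ∙ ((σ k ⁻¹) ∙ σ k) ≡⟨ cong ((k ∙ h) ∙_) (inverseˡ (σ k)) ⟩
        (k ∙ h) ∙ ε                ≡⟨ identityʳ (k ∙ h) ⟩
        k ∙ h                      ∎
        where open ≡-Reasoning

      h≡h′ : h ≡ h′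
      h≡h′ = singleton h h′ (conj-by-H k h h′ h′∙σk≡k∙h)

    σ≗id : ∀ h → σ h ≡ h
    σ≗id h = trans (sym (identityˡ (σ h))) (trans (twisted-comm ε h) (identityʳ h))

    comm : ∀ x y → x ∙ y ≡ y ∙ x
    comm x y = trans (cong (x ∙_) (sym (σ≗id y))) (twisted-comm x y)

    square : (∀ h → InS (h , true)) → ∀ h → h ∙ h ≡ ε
    square involution h = trans (cong (h ∙_) (sym (σ≗id h))) (cong proj₁ (proj₂ (involution h)))

  module FullCount (count : TFClassCount n) where

    open TFClassCount count

    rep-outer : ∀ i → rep i ≡ (proj₁ (rep i) , true)
    rep-outer i with rep i | proj₁ (rep-in-S i)
    ... | h , .true | refl = refl

    rep-injective : Injective _≡_ _≡_ (λ i → proj₁ (rep i))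
    rep-injective {i} {j} e =
      distinct i j (subst (Conj (rep i)) (trans (rep-outer i) (trans (cong (_, true) e) (sym (rep-outer j))))
                          (rep i , refl))

    outer-rep : ∀ h → ∃ λ i → rep i ≡ (h , true)
    outer-rep h with injective⇒surjective rep-injective h
    ... | i , e = i , trans (rep-outer i) (cong (_, true) e)

    outer-involution : ∀ h → InS (h , true)
    outer-involution h with outer-rep h
    ... | i , e = subst InS e (rep-in-S i)

    outer-singleton : ∀ h h′ → Conj (h , true) (h′ , true) → h ≡ h′
    outer-singleton h h′ c with outer-rep h | outer-rep h′
    ... | i , eᵢ | j , eⱼ = cong proj₁ (trans (sym eᵢ) (trans (cong rep i≡j) eⱼ))
      where
      i≡j : i ≡ j
      i≡j = distinct i j (subst₂ Conj (sym eᵢ) (sym eⱼ) c)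

theorem10p8 : (n : ℕ) (H : FinGroup n) (σ : Fin n → Fin n) →
    IsAutomorphism H σ → (∀ h → σ (σ h) ≡ h) →
    SemiDirect.TFClassCount H σ n →
    ∃ λ (k : ℕ) → IsoToZ2Pow H k × (∀ h → σ h ≡ h)
theorem10p8 n H σ _ _ count = proj₁ iso , proj₂ iso , σ≗id
  where
  open OuterCoset H σ
  open FullCount count
  open SingletonClasses outer-singleton

  iso : ∃ λ k → IsoToZ2Pow H k
  iso = ElementaryAbelian.iso-Z₂^ H comm (square outer-involution)
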